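{- For all closed $\lambda$-terms $M$, $N$ and $P$, if $M =_{\omega} N$ and $N =_{\omega} P$ then $M =_{\omega} P$.
   Context: $[N/x]U$ is capture-avoiding substitution; $\mathbf{\Omega}\equiv(\lambda x.xx)(\lambda x.xx)$; a closed term is unsolvable if no application of it to closed terms $\beta$-converts to $\lambda x.x$. The relation $=_{\omega}$ on closed terms is the least relation such that: $M=_\omega M$; $(\lambda x.U)N =_{\omega} [N/x]U$ and $[N/x]U =_\omega (\lambda x.U)N$ for closed $(\lambda x.U)N$; $M=_\omega\mathbf{\Omega}$ and $\mathbf{\Omega}=_\omega M$ for closed unsolvable $M$; if $X,Y$ have no free variable other than possibly $z$, $[M/z]X=_\omega[M/z]Y$ and $M=_\omega N$, then $[N/z]X=_\omega[N/z]Y$ (Leibniz rule); and if $PM=_\omega QM$ for all closed $M$ then $P=_\omega Q$ ($\omega$-rule). -}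

module Defs where

open import Data.Nat using (ℕ; zero; suc)
open import Data.Fin using (Fin; zero; suc)
open import Data.List using (List; []; _∷_)
open import Data.Product using (Σ)
open import Relation.Nullary using (¬_)
open import Relation.Binary.Construct.Closure.Equivalence using (EqClosure)

-- Well-scoped de Bruijn λ-terms: Term n has free variables among n.
-- Closed terms are Term 0 (terms are identified up to α-conversion).
infixl 7 _·_
data Term (n : ℕ) : Set where
  var : Fin n → Term n
  ƛ   : Term (suc n) → Term n
  _·_ : Term n → Term n → Term n

ext : ∀ {m n} → (Fin m → Fin n) → Fin (suc m) → Fin (suc n)
ext ρ zero    = zero
ext ρ (suc i) = suc (ρ i)

rename : ∀ {m n} → (Fin m → Fin n) → Term m → Term n
rename ρ (var i) = var (ρ i)
rename ρ (ƛ t)   = ƛ (rename (ext ρ) t)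
rename ρ (t · u) = rename ρ t · rename ρ u

exts : ∀ {m n} → (Fin m → Term n) → Fin (suc m) → Term (suc n)
exts σ zero    = var zero
exts σ (suc i) = rename suc (σ i)

sub : ∀ {m n} → (Fin m → Term n) → Term m → Term n
sub σ (var i) = σ i
sub σ (ƛ t)   = ƛ (sub (exts σ) t)
sub σ (t · u) = sub σ t · sub σ u

single : ∀ {n} → Term n → Fin (suc n) → Term n
single N zero    = N
single N (suc i) = var i

_[_] : ∀ {n} → Term (suc n) → Term n → Term n
U [ N ] = sub (single N) U

infix 4 _⟶β_
data _⟶β_ {n : ℕ} : Term n → Term n → Set where
  β    : ∀ {U N} → ƛ U · N ⟶β U [ N ]
  ξ-ƛ  : ∀ {U U'} → U ⟶β U' → ƛ U ⟶β ƛ U'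
  ξ-·₁ : ∀ {L L' M} → L ⟶β L' → L · M ⟶β L' · M
  ξ-·₂ : ∀ {L M M'} → M ⟶β M' → L · M ⟶β L · M'

_=β_ : ∀ {n} → Term n → Term n → Set
_=β_ = EqClosure _⟶β_

apps : ∀ {n} → Term n → List (Term n) → Term n
apps M []       = M
apps M (N ∷ Ns) = apps (M · N) Ns

I : Term 0
I = ƛ (var zero)

Ω : Term 0
Ω = ƛ (var zero · var zero) · ƛ (var zero · var zero)

Unsolvable : Term 0 → Set
Unsolvable M = ¬ Σ (List (Term 0)) (λ Ns → apps M Ns =β I)

infix 4 _=ω_
data _=ω_ : Term 0 → Term 0 → Set where
  ω-refl    : ∀ {M} → M =ω M
  ω-β→      : ∀ {U : Term 1} {N : Term 0} → ƛ U · N =ω U [ N ]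
  ω-β←      : ∀ {U : Term 1} {N : Term 0} → U [ N ] =ω ƛ U · N
  ω-Ω→      : ∀ {M} → Unsolvable M → M =ω Ω
  ω-Ω←      : ∀ {M} → Unsolvable M → Ω =ω M
  ω-leibniz : ∀ {X Y : Term 1} {M N : Term 0} →
              X [ M ] =ω Y [ M ] → M =ω N → X [ N ] =ω Y [ N ]
  ω-rule    : ∀ {P Q : Term 0} → (∀ (M : Term 0) → P · M =ω Q · M) → P =ω Q

module Submission where

open import Defs
open import Data.Fin using (Fin; zero; suc)
open import Relation.Binary.PropositionalEquality using (_≡_; refl; cong; cong₂; subst; sym)

sub-rename-cancel : ∀ {m n} (ρ : Fin m → Fin n) (σ : Fin n → Term m) →
                    (∀ i → σ (ρ i) ≡ var i) → ∀ t → sub σ (rename ρ t) ≡ t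
sub-rename-cancel ρ σ σ∘ρ≡var (var i) = σ∘ρ≡var i
sub-rename-cancel ρ σ σ∘ρ≡var (ƛ t)   =
  cong ƛ (sub-rename-cancel (ext ρ) (exts σ) exts∘ext≡var t)
  where
  exts∘ext≡var : ∀ i → exts σ (ext ρ i) ≡ var i
  exts∘ext≡var zero    = refl
  exts∘ext≡var (suc i) = cong (rename suc) (σ∘ρ≡var i)
sub-rename-cancel ρ σ σ∘ρ≡var (t · u) =
  cong₂ _·_ (sub-rename-cancel ρ σ σ∘ρ≡var t) (sub-rename-cancel ρ σ σ∘ρ≡var u)

weaken : Term 0 → Term 1
weaken = rename (λ ())

weaken-[] : ∀ M N → weaken M [ N ] ≡ M
weaken-[] M N = sub-rename-cancel (λ ()) (single N) (λ ()) M

-- Leibniz rule with X := M (z not free) and Y := z: from [N/z]X = [N/z]Y, i.e. M = N,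
-- and N = P we get [P/z]X = [P/z]Y, i.e. M = P.
proposition3p2 : (M N P : Term 0) → M =ω N → N =ω P → M =ω P
proposition3p2 M N P M=N N=P =
  subst (_=ω P) (weaken-[] M P)
    (ω-leibniz {X = weaken M} {Y = var zero}
      (subst (_=ω N) (sym (weaken-[] M N)) M=N) N=P)
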